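{- Let $n \ge 3$, let $G = C_n$ be the cycle of order $n$, and let $f: V(G_1)\to V(G_2)$ be any function with $|f(V(G_1))| = s$, where $1 < s < n$. Then $2 \le \dim(C(C_n, f)) \le 2(n-1)-s$.
   Context: For a connected graph $H$, a set $S \subseteq V(H)$ is a resolving set if for every two distinct vertices $x,y$ of $H$ there is $s \in S$ with $d_H(x,s) \neq d_H(y,s)$; the metric dimension $\dim(H)$ is the minimum cardinality of a resolving set of $H$. Given a graph $G$, let $G_1$ and $G_2$ be disjoint copies of $G$ and let $f: V(G_1)\to V(G_2)$ be a function. The functigraph $C(G,f)$ is the graph with vertex set $V(G_1)\cup V(G_2)$ and edge set $E(G_1)\cup E(G_2)\cup\{uv \mid u \in V(G_1),\ v=f(u)\}$. -}

module Defs where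

open import Data.Nat using (ℕ; zero; suc; _+_; _<_; _%_)
open import Data.Fin using (Fin; toℕ)
open import Data.Fin.Properties using (any?; _≟_)
open import Data.Sum using (_⊎_; inj₁; inj₂)
open import Data.Product using (Σ; _×_; ∃)
open import Data.List using (List; length; filter; allFin)
open import Data.List.Membership.Propositional using (_∈_)
open import Data.List.Relation.Unary.Unique.Propositional using (Unique)
open import Relation.Binary.PropositionalEquality using (_≡_; _≢_)
open import Relation.Nullary using (¬_)

data Walk {V : Set} (Adj : V → V → Set) : ℕ → V → V → Set where
  here : ∀ {x} → Walk Adj zero x x
  step : ∀ {k x y z} → Adj x y → Walk Adj k y z → Walk Adj (suc k) x z

Dist : {V : Set} → (V → V → Set) → V → V → ℕ → Set
Dist Adj x y k = Walk Adj k x y × (∀ m → m < k → ¬ Walk Adj m x y)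

Resolving : {V : Set} → (V → V → Set) → List V → Set
Resolving {V} Adj S =
  ∀ (x y : V) → x ≢ y →
    Σ V λ s → s ∈ S × Σ ℕ λ dx → Σ ℕ λ dy →
      Dist Adj x s dx × Dist Adj y s dy × dx ≢ dy

-- A resolving set, as a duplicate-free list (its cardinality is its length).
ResolvingSet : {V : Set} → (V → V → Set) → List V → Set
ResolvingSet Adj S = Unique S × Resolving Adj S

IsMetricDim : {V : Set} → (V → V → Set) → ℕ → Set
IsMetricDim Adj d =
  (Σ _ λ S → ResolvingSet Adj S × length S ≡ d) ×
  (∀ S → ResolvingSet Adj S → d Data.Nat.≤ length S)

CycleAdj : (n : ℕ) → Fin n → Fin n → Set
CycleAdj (suc n) i j =
  (toℕ j ≡ (suc (toℕ i)) % suc n) ⊎ (toℕ i ≡ (suc (toℕ j)) % suc n)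
CycleAdj zero () _

-- Functigraph C(G,f): vertices V(G₁) ⊎ V(G₂) (inj₁ = G₁, inj₂ = G₂),
-- edges of both copies plus u f(u) for u ∈ V(G₁).

FunctiAdj : {A : Set} → (A → A → Set) → (A → A) → A ⊎ A → A ⊎ A → Set
FunctiAdj Adj f (inj₁ u) (inj₁ v) = Adj u v
FunctiAdj Adj f (inj₂ u) (inj₂ v) = Adj u v
FunctiAdj Adj f (inj₁ u) (inj₂ v) = v ≡ f u
FunctiAdj Adj f (inj₂ v) (inj₁ u) = v ≡ f u

imageSize : {n : ℕ} → (Fin n → Fin n) → ℕ
imageSize {n} f = length (filter (λ v → any? (λ u → f u ≟ v)) (allFin n))

module Submission where

-- In a finite connected graph with decidable adjacency,
-- distances are computable, "S is resolving" is decidable and lists of a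
-- given length can be enumerated, so bounded minimisation yields the metric
-- dimension d together with d ≤ |S₀| for any resolving set S₀ at hand.
--
-- Lower bound: no set of size ≤ 1 resolves, since a
-- single landmark cannot separate its two cycle neighbours.  Upper bound:
-- given an "anchor" — a vertex u₀ of G₁ sharing its image with another
-- vertex, a vertex a of G₂ outside the image, and an escape vertex for the
-- case f(u₀ - 1) = f(u₀ + 1) — the set S₀ = (V(G₁) ∖ {u₀}) ∪ (non-image of
-- G₂ ∖ {a}) resolves and has size ≤ (n-1) + (n-s-1).  An anchor exists
-- directly unless f is 2-periodic along the cycle; in that case the image
-- is {α, β}, and s > 1 forces n ≥ 4, leaving room for the escape vertex.

open import Defs
open import Data.Nat using (ℕ; zero; suc; _+_; _≤_; _<_; _∸_; _*_; z≤n; s≤s; _%_)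
import Data.Nat.Properties as ℕ
open import Data.Nat.DivMod using (%-distribˡ-+; m%n%n≡m%n; m<n⇒m%n≡m; [m+n]%n≡m%n; m%n<n)
open import Data.Fin using (Fin; toℕ; fromℕ<)
import Data.Fin as Fin
open import Data.Fin.Properties using (any?; all?; ¬∀⟶∃¬; toℕ-fromℕ<; toℕ-injective; toℕ<n) renaming (_≟_ to _≟F_)
open import Data.Sum using (_⊎_; inj₁; inj₂; [_,_])
open import Data.Sum.Properties using (inj₁-injective; inj₂-injective; ≡-dec)
open import Data.Product using (Σ; _×_; _,_; proj₁; proj₂; ∃)
open import Data.List using (List; []; _∷_; length; map; _++_; concatMap; filter; allFin)
open import Data.List.Properties using (length-++; length-map; length-tabulate; filter-notAll; filter-all)
open import Data.List.Relation.Unary.Any as Any using (Any; here; there)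
open import Data.List.Relation.Unary.All as All using (All)
open import Data.List.Relation.Unary.AllPairs as AllPairs using ()
open import Data.List.Relation.Unary.Unique.Propositional using (Unique)
open import Data.List.Relation.Unary.Unique.Propositional.Properties using (map⁺; ++⁺; filter⁺; allFin⁺)
open import Data.List.Membership.Propositional using (_∈_; find; lose)
open import Data.List.Membership.Propositional.Properties
  using (∈-map⁺; ∈-map⁻; ∈-++⁺ˡ; ∈-++⁺ʳ; ∈-++⁻; ∈-∃++; ∈-concatMap⁺; ∈-concatMap⁻; ∈-filter⁺; ∈-filter⁻; ∈-allFin)
open import Data.Empty using (⊥-elim)
open import Relation.Nullary using (¬_; Dec; yes; no)
open import Relation.Nullary.Decidable using (_×-dec_; _⊎-dec_; _→-dec_; ¬?)
open import Relation.Unary using (Pred; Decidable)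
open import Relation.Binary using (DecidableEquality; tri<; tri≈; tri>)
open import Relation.Binary.PropositionalEquality using (_≡_; _≢_; refl; sym; trans; cong; cong₂; subst; module ≡-Reasoning)
open import Function using (_∘_)
open import Level using (0ℓ)

leastWitness : (P : ℕ → Set) → (∀ k → Dec (P k)) → ∀ L → P L →
               Σ ℕ λ k → P k × k ≤ L × (∀ j → j < k → ¬ P j)
leastWitness P P? L pL with P? 0
... | yes p0 = 0 , p0 , z≤n , λ j ()
leastWitness P P? zero pL | no ¬p0 = ⊥-elim (¬p0 pL)
leastWitness P P? (suc L) pL | no ¬p0
  with k , pk , k≤L , below ← leastWitness (P ∘ suc) (P? ∘ suc) L pL
  = suc k , pk , s≤s k≤L , λ { zero _ → ¬p0 ; (suc j) (s≤s j<k) → below j j<k }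

Path : {V : Set} → (V → V → Set) → V → V → Set
Path Adj x y = Σ ℕ λ k → Walk Adj k x y

module _ {V : Set} {Adj : V → V → Set} where

  appendWalk : ∀ {k l x y z} → Walk Adj k x y → Walk Adj l y z → Walk Adj (k + l) x z
  appendWalk here w = w
  appendWalk (step e v) w = step e (appendWalk v w)

  _⊕_ : ∀ {x y z} → Path Adj x y → Path Adj y z → Path Adj x z
  (k , v) ⊕ (l , w) = k + l , appendWalk v w

  edge : ∀ {x y} → Adj x y → Path Adj x y
  edge e = 1 , step e here

  reversePath : (∀ {x y} → Adj x y → Adj y x) → ∀ {k x y} → Walk Adj k x y → Path Adj y x
  reversePath adj-sym here = 0 , here
  reversePath adj-sym (step e w) = reversePath adj-sym w ⊕ edge (adj-sym e)

  walk-zero : ∀ {x y} → Walk Adj 0 x y → x ≡ y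
  walk-zero here = refl

  walk-one : ∀ {x y} → Walk Adj 1 x y → Adj x y
  walk-one (step e here) = e

  Dist-unique : ∀ {x y a b} → Dist Adj x y a → Dist Adj x y b → a ≡ b
  Dist-unique {a = a} {b} (wa , minA) (wb , minB) with ℕ.<-cmp a b
  ... | tri< a<b _ _ = ⊥-elim (minB a a<b wa)
  ... | tri≈ _ a≡b _ = a≡b
  ... | tri> _ _ b<a = ⊥-elim (minA b b<a wb)

  Dist-one : ∀ {x s} → Adj x s → x ≢ s → Dist Adj x s 1
  Dist-one e x≢s = step e here , λ { zero _ w → x≢s (walk-zero w) ; (suc j) (s≤s ()) }

mapWalk : ∀ {A B : Set} {AdjA : A → A → Set} {AdjB : B → B → Set} (g : A → B) →
          (∀ {x y} → AdjA x y → AdjB (g x) (g y)) → ∀ {k x y} → Walk AdjA k x y → Walk AdjB k (g x) (g y)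
mapWalk g hom here = here
mapWalk g hom (step e w) = step (hom e) (mapWalk g hom w)

Separated : {V : Set} → (V → V → Set) → List V → V → V → Set
Separated {V} Adj S x y =
  Σ V λ s → s ∈ S × Σ ℕ λ dx → Σ ℕ λ dy → Dist Adj x s dx × Dist Adj y s dy × dx ≢ dy

Separated-sym : ∀ {V : Set} {Adj : V → V → Set} {S x y} → Separated Adj S x y → Separated Adj S y x
Separated-sym (s , s∈S , dx , dy , Dx , Dy , dx≢dy) = s , s∈S , dy , dx , Dy , Dx , dx≢dy ∘ sym

singleton-notResolving : ∀ {V : Set} {Adj : V → V → Set} {s x y : V} →
  Adj x s → x ≢ s → Adj y s → y ≢ s → x ≢ y → ¬ Resolving Adj (s ∷ [])
singleton-notResolving ex x≢s ey y≢s x≢y resolves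
  with resolves _ _ x≢y
... | _ , here refl , dx , dy , Dx , Dy , dx≢dy =
  dx≢dy (trans (Dist-unique Dx (Dist-one ex x≢s)) (Dist-unique (Dist-one ey y≢s) Dy))

module FiniteGraph {V : Set} (_≟_ : DecidableEquality V) (vertices : List V)
  (∈-vertices : ∀ x → x ∈ vertices)
  (Adj : V → V → Set) (adj? : ∀ x y → Dec (Adj x y))
  (connected : ∀ x y → Path Adj x y) where

  walk? : ∀ k x y → Dec (Walk Adj k x y)
  walk? zero x y with x ≟ y
  ... | yes refl = yes here
  ... | no x≢y = no (x≢y ∘ walk-zero)
  walk? (suc k) x y with Any.any? (λ z → adj? x z ×-dec walk? k z y) vertices
  ... | yes some with _ , _ , (e , w) ← find some = yes (step e w)
  ... | no none = no λ { (step {y = z} e w) → none (lose (∈-vertices z) (e , w)) }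

  shortest : ∀ x y → Σ ℕ λ k → Walk Adj k x y × k ≤ proj₁ (connected x y) × (∀ j → j < k → ¬ Walk Adj j x y)
  shortest x y = leastWitness (λ k → Walk Adj k x y) (λ k → walk? k x y) (proj₁ (connected x y)) (proj₂ (connected x y))

  distance : V → V → ℕ
  distance x y = proj₁ (shortest x y)

  distance-correct : ∀ x y → Dist Adj x y (distance x y)
  distance-correct x y with _ , w , _ , minimal ← shortest x y = w , minimal

  separate-by-member : ∀ {S x y} → x ∈ S → x ≢ y → Separated Adj S x y
  separate-by-member {y = y} x∈S x≢y =
    _ , x∈S , 0 , distance y _ , (here , λ j ()) , distance-correct y _ ,
    λ 0≡d → x≢y (sym (walk-zero (subst (λ k → Walk Adj k y _) (sym 0≡d) (proj₁ (distance-correct y _)))))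

  separate-by-neighbour : ∀ {S x y s} → s ∈ S → Adj x s → x ≢ s → ¬ Adj y s → y ≢ s → Separated Adj S x y
  separate-by-neighbour {y = y} {s} s∈S ex x≢s ¬ey y≢s =
    s , s∈S , 1 , distance y s , Dist-one ex x≢s , distance-correct y s ,
    λ 1≡d → ¬ey (walk-one (subst (λ k → Walk Adj k y s) (sym 1≡d) (proj₁ (distance-correct y s))))

  Resolves : List V → Set
  Resolves S = All (λ x → All (λ y → x ≢ y → Any (λ s → distance x s ≢ distance y s) S) vertices) vertices

  resolves? : ∀ S → Dec (Resolves S)
  resolves? S = All.all? (λ x → All.all? (λ y →
    ¬? (x ≟ y) →-dec Any.any? (λ s → ¬? (distance x s ℕ.≟ distance y s)) S) vertices) vertices

  Resolves⇒Resolving : ∀ S → Resolves S → Resolving Adj S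
  Resolves⇒Resolving S r x y x≢y
    with s , s∈S , d≢d ← find (All.lookup (All.lookup r (∈-vertices x)) (∈-vertices y) x≢y)
    = s , s∈S , distance x s , distance y s , distance-correct x s , distance-correct y s , d≢d

  Resolving⇒Resolves : ∀ S → Resolving Adj S → Resolves S
  Resolving⇒Resolves S r = All.tabulate λ {x} _ → All.tabulate λ {y} _ x≢y →
    let (s , s∈S , dx , dy , Dx , Dy , dx≢dy) = r x y x≢y in
    lose s∈S λ d≡d → dx≢dy (trans (Dist-unique Dx (distance-correct x s))
                           (trans d≡d (Dist-unique (distance-correct y s) Dy)))

  listsOfLength : ℕ → List (List V)
  listsOfLength zero = [] ∷ []
  listsOfLength (suc k) = concatMap (λ x → map (x ∷_) (listsOfLength k)) vertices

  ∈-listsOfLength : ∀ S → S ∈ listsOfLength (length S)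
  ∈-listsOfLength [] = here refl
  ∈-listsOfLength (x ∷ S) = ∈-concatMap⁺ (λ z → map (z ∷_) (listsOfLength (length S)))
    (lose (∈-vertices x) (∈-map⁺ (x ∷_) (∈-listsOfLength S)))

  listsOfLength-length : ∀ k S → S ∈ listsOfLength k → length S ≡ k
  listsOfLength-length zero .[] (here refl) = refl
  listsOfLength-length (suc k) S S∈
    with x , _ , S∈′ ← find (∈-concatMap⁻ (λ x → map (x ∷_) (listsOfLength k)) {xs = vertices} S∈)
    with T , T∈ , refl ← ∈-map⁻ (x ∷_) S∈′
    = cong suc (listsOfLength-length k T T∈)

  ResolvingOfSize : ℕ → Set
  ResolvingOfSize k = Any (λ S → Unique S × Resolves S) (listsOfLength k)

  resolvingOfSize? : ∀ k → Dec (ResolvingOfSize k)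
  resolvingOfSize? k = Any.any? (λ S → AllPairs.allPairs? (λ x y → ¬? (x ≟ y)) S ×-dec resolves? S) (listsOfLength k)

  resolvingOfSize : ∀ S → ResolvingSet Adj S → ResolvingOfSize (length S)
  resolvingOfSize S (uS , rS) = lose (∈-listsOfLength S) (uS , Resolving⇒Resolves S rS)

  metricDimension : (S₀ : List V) → ResolvingSet Adj S₀ →
    Σ ℕ λ d → IsMetricDim Adj d × d ≤ length S₀
  metricDimension S₀ rs₀
    with d , witness , d≤ , below ← leastWitness ResolvingOfSize resolvingOfSize? (length S₀) (resolvingOfSize S₀ rs₀)
    with S , S∈ , (uS , rS) ← find witness
    = d , ((S , (uS , Resolves⇒Resolving S rS) , listsOfLength-length d S S∈) ,
           λ T rsT → ℕ.≮⇒≥ λ T<d → below (length T) T<d (resolvingOfSize T rsT)) , d≤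

module _ {A : Set} where

  length-filter-split : {P : Pred A 0ℓ} (P? : Decidable P) (xs : List A) →
    length (filter P? xs) + length (filter (¬? ∘ P?) xs) ≡ length xs
  length-filter-split P? [] = refl
  length-filter-split P? (x ∷ xs) with P? x
  ... | yes _ = cong suc (length-filter-split P? xs)
  ... | no _ = trans (ℕ.+-suc _ _) (cong suc (length-filter-split P? xs))

  unique-⊆⇒length≤ : ∀ {xs : List A} → Unique xs → (ys : List A) →
    (∀ {z} → z ∈ xs → z ∈ ys) → length xs ≤ length ys
  unique-⊆⇒length≤ {[]} _ ys xs⊆ys = z≤n
  unique-⊆⇒length≤ {x ∷ xs} (x∉xs AllPairs.∷ uxs) ys xs⊆ys
    with ys₁ , ys₂ , refl ← ∈-∃++ (xs⊆ys (here refl))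
    = subst (suc (length xs) ≤_) (sym length-ys) (s≤s (unique-⊆⇒length≤ uxs (ys₁ ++ ys₂) xs⊆ys₁++ys₂))
    where
    length-ys : length (ys₁ ++ x ∷ ys₂) ≡ suc (length (ys₁ ++ ys₂))
    length-ys = trans (length-++ ys₁) (trans (ℕ.+-suc (length ys₁) (length ys₂)) (cong suc (sym (length-++ ys₁))))
    xs⊆ys₁++ys₂ : ∀ {z} → z ∈ xs → z ∈ ys₁ ++ ys₂
    xs⊆ys₁++ys₂ {z} z∈xs with ∈-++⁻ ys₁ (xs⊆ys (there z∈xs))
    ... | inj₁ z∈ys₁ = ∈-++⁺ˡ z∈ys₁
    ... | inj₂ (here refl) = ⊥-elim (All.lookup x∉xs z∈xs refl)
    ... | inj₂ (there z∈ys₂) = ∈-++⁺ʳ ys₁ z∈ys₂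

-- Counting behind the upper bound: x ≤ N-1 and y ≤ (N-s)-1 give
-- x + y ≤ 2(N-1) - s, written with N = suc m.
sum-bound : ∀ {m x y c} s → x < suc m → y < c → s + c ≡ suc m → x + y ≤ 2 * m ∸ s
sum-bound {m} {x} {y} {c} s x<N y<c s+c≡N = ℕ.m+n≤o⇒m≤o∸n (x + y) (begin
    x + y + s   ≡⟨ ℕ.+-assoc x y s ⟩
    x + (y + s) ≤⟨ ℕ.+-mono-≤ (ℕ.≤-pred x<N) y+s≤m ⟩
    m + m       ≡⟨ cong (m +_) (sym (ℕ.+-identityʳ m)) ⟩
    2 * m       ∎)
  where
  open ℕ.≤-Reasoning
  y+s≤m : y + s ≤ m
  y+s≤m = ℕ.≤-pred (begin
    suc (y + s) ≡⟨ cong suc (ℕ.+-comm y s) ⟩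
    suc (s + y) ≡⟨ sym (ℕ.+-suc s y) ⟩
    s + suc y   ≤⟨ ℕ.+-monoʳ-≤ s y<c ⟩
    s + c       ≡⟨ s+c≡N ⟩
    suc m       ∎)

-- The cycle C_N with N = k + 3 ≥ 3 vertices 0, …, N-1; next and prev are
-- the two neighbours i+1 and i-1 (mod N).
module Cycle (k : ℕ) where

  m N : ℕ
  m = 2 + k
  N = suc m

  mod-add : ∀ a b → (a % N + b) % N ≡ (a + b) % N
  mod-add a b = begin
    (a % N + b) % N           ≡⟨ %-distribˡ-+ (a % N) b N ⟩
    (a % N % N + b % N) % N   ≡⟨ cong (λ t → (t + b % N) % N) (m%n%n≡m%n a N) ⟩
    (a % N + b % N) % N       ≡⟨ sym (%-distribˡ-+ a b N) ⟩
    (a + b) % N               ∎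
    where open ≡-Reasoning

  mod-suc : ∀ a → suc (a % N) % N ≡ suc a % N
  mod-suc a = trans (cong (_% N) (ℕ.+-comm 1 (a % N))) (trans (mod-add a 1) (cong (_% N) (ℕ.+-comm a 1)))

  mod-add-N : ∀ (i : Fin N) → (toℕ i + N) % N ≡ toℕ i
  mod-add-N i = trans ([m+n]%n≡m%n (toℕ i) N) (m<n⇒m%n≡m (toℕ<n i))

  shift-moves : ∀ u c → 0 < c → c < N → u < N → (u + c) % N ≢ u
  shift-moves u c 0<c c<N u<N u+c≡u with u + c ℕ.<? N
  ... | yes u+c<N = ℕ.<⇒≢ (ℕ.m<m+n u 0<c) (sym (trans (sym (m<n⇒m%n≡m u+c<N)) u+c≡u))
  ... | no u+c≮N = ℕ.<⇒≢ c<N (sym N≡c)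
    where
    r : ℕ
    r = u + c ∸ N
    r+N≡u+c : r + N ≡ u + c
    r+N≡u+c = ℕ.m∸n+n≡m (ℕ.≮⇒≥ u+c≮N)
    r<N : r < N
    r<N = ℕ.+-cancelʳ-< N r N (subst (_< N + N) (sym r+N≡u+c) (ℕ.+-mono-< u<N c<N))
    r≡u : r ≡ u
    r≡u = trans (sym (m<n⇒m%n≡m r<N)) (trans (sym ([m+n]%n≡m%n r N)) (trans (cong (_% N) r+N≡u+c) u+c≡u))
    N≡c : N ≡ c
    N≡c = ℕ.+-cancelˡ-≡ u N c (trans (cong (_+ N) (sym r≡u)) r+N≡u+c)

  next prev : Fin N → Fin N
  next i = fromℕ< (m%n<n (suc (toℕ i)) N)
  prev i = fromℕ< (m%n<n (toℕ i + m) N)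

  toℕ-next : ∀ i → toℕ (next i) ≡ suc (toℕ i) % N
  toℕ-next i = toℕ-fromℕ< (m%n<n (suc (toℕ i)) N)

  toℕ-prev : ∀ i → toℕ (prev i) ≡ (toℕ i + m) % N
  toℕ-prev i = toℕ-fromℕ< (m%n<n (toℕ i + m) N)

  prev-next : ∀ i → prev (next i) ≡ i
  prev-next i = toℕ-injective (begin
    toℕ (prev (next i))           ≡⟨ toℕ-prev (next i) ⟩
    (toℕ (next i) + m) % N        ≡⟨ cong (λ t → (t + m) % N) (toℕ-next i) ⟩
    (suc (toℕ i) % N + m) % N     ≡⟨ mod-add (suc (toℕ i)) m ⟩
    (suc (toℕ i) + m) % N         ≡⟨ cong (_% N) (sym (ℕ.+-suc (toℕ i) m)) ⟩
    (toℕ i + N) % N               ≡⟨ mod-add-N i ⟩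
    toℕ i                         ∎)
    where open ≡-Reasoning

  next-prev : ∀ i → next (prev i) ≡ i
  next-prev i = toℕ-injective (begin
    toℕ (next (prev i))           ≡⟨ toℕ-next (prev i) ⟩
    suc (toℕ (prev i)) % N        ≡⟨ cong (λ t → suc t % N) (toℕ-prev i) ⟩
    suc ((toℕ i + m) % N) % N     ≡⟨ mod-suc (toℕ i + m) ⟩
    suc (toℕ i + m) % N           ≡⟨ cong (_% N) (sym (ℕ.+-suc (toℕ i) m)) ⟩
    (toℕ i + N) % N               ≡⟨ mod-add-N i ⟩
    toℕ i                         ∎)
    where open ≡-Reasoning

  adj-next : ∀ i → CycleAdj N i (next i)
  adj-next i = inj₁ (toℕ-next i)

  adj-prev : ∀ i → CycleAdj N (prev i) i
  adj-prev i = inj₁ (trans (cong toℕ (sym (next-prev i))) (toℕ-next (prev i)))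

  adj-sym : ∀ {x y} → CycleAdj N x y → CycleAdj N y x
  adj-sym (inj₁ e) = inj₂ e
  adj-sym (inj₂ e) = inj₁ e

  adj? : ∀ x y → Dec (CycleAdj N x y)
  adj? x y = (toℕ y ℕ.≟ suc (toℕ x) % N) ⊎-dec (toℕ x ℕ.≟ suc (toℕ y) % N)

  -- The two neighbours of a vertex are distinct from it and from each other
  -- (this is where N ≥ 3 is used).
  next≢ : ∀ i → next i ≢ i
  next≢ i next≡i = shift-moves (toℕ i) 1 (s≤s z≤n) (s≤s (s≤s z≤n)) (toℕ<n i)
    (trans (cong (_% N) (ℕ.+-comm (toℕ i) 1)) (trans (sym (toℕ-next i)) (cong toℕ next≡i)))

  prev≢ : ∀ i → prev i ≢ i
  prev≢ i prev≡i = next≢ i (trans (cong next (sym prev≡i)) (next-prev i))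

  next-next≢ : ∀ i → next (next i) ≢ i
  next-next≢ i nn≡i = shift-moves (toℕ i) 2 (s≤s z≤n) (s≤s (s≤s (s≤s z≤n))) (toℕ<n i)
    (trans (cong (_% N) (ℕ.+-comm (toℕ i) 2))
      (trans (sym (mod-suc (suc (toℕ i))))
      (trans (cong (λ t → suc t % N) (sym (toℕ-next i)))
      (trans (sym (toℕ-next (next i))) (cong toℕ nn≡i)))))

  next≢prev : ∀ i → next i ≢ prev i
  next≢prev i n≡p = next-next≢ i (trans (cong next n≡p) (next-prev i))

  next-next≡prev : k ≡ 0 → ∀ i → next (next i) ≡ prev i
  next-next≡prev refl i = toℕ-injective (trans (toℕ-next (next i))
    (trans (cong (λ t → suc t % N) (toℕ-next i))
    (trans (mod-suc (suc (toℕ i)))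
    (trans (cong (_% N) (ℕ.+-comm 2 (toℕ i))) (sym (toℕ-prev i))))))

  toℕ-prev-suc : ∀ i j → toℕ i ≡ suc j → toℕ (prev i) ≡ j
  toℕ-prev-suc i j i≡1+j = trans (toℕ-prev i) (trans (cong (λ t → (t + m) % N) i≡1+j)
    (trans (cong (_% N) (sym (ℕ.+-suc j m))) (trans ([m+n]%n≡m%n j N)
      (m<n⇒m%n≡m (ℕ.<-trans (ℕ.n<1+n j) (subst (_< N) i≡1+j (toℕ<n i)))))))

  closed-prev⇒zero : (Q : Fin N → Set) → (∀ i → Q i → Q (prev i)) → ∀ p → Q p → Q Fin.zero
  closed-prev⇒zero Q closed p q = go (toℕ p) p refl q
    where
    go : ∀ j i → toℕ i ≡ j → Q i → Q Fin.zero
    go zero i i≡0 q = subst Q (toℕ-injective i≡0) q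
    go (suc j) i i≡1+j q = go j (prev i) (toℕ-prev-suc i j i≡1+j) (closed i q)

  closed-next⇒all : (Q : Fin N → Set) → Q Fin.zero → (∀ i → Q i → Q (next i)) → ∀ i → Q i
  closed-next⇒all Q q₀ closed i = go (toℕ i) i refl
    where
    go : ∀ j i → toℕ i ≡ j → Q i
    go zero i i≡0 = subst Q (sym (toℕ-injective i≡0)) q₀
    go (suc j) i i≡1+j = subst Q (toℕ-injective next-i′≡i) (closed i′ (go j i′ (toℕ-fromℕ< j<N)))
      where
      1+j<N : suc j < N
      1+j<N = subst (_< N) i≡1+j (toℕ<n i)
      j<N : j < N
      j<N = ℕ.<-trans (ℕ.n<1+n j) 1+j<N
      i′ : Fin N
      i′ = fromℕ< j<N
      next-i′≡i : toℕ (next i′) ≡ toℕ i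
      next-i′≡i = trans (toℕ-next i′) (trans (cong (λ t → suc t % N) (toℕ-fromℕ< j<N))
                    (trans (m<n⇒m%n≡m 1+j<N) (sym i≡1+j)))

  cycle-induction : (Q : Fin N → Set) → (∀ i → Q i → Q (next i)) → (∀ i → Q i → Q (prev i)) →
                    ∀ p → Q p → ∀ i → Q i
  cycle-induction Q closed-next closed-prev p q =
    closed-next⇒all Q (closed-prev⇒zero Q closed-prev p q) closed-next

  connected : ∀ i j → Path (CycleAdj N) i j
  connected i j = reversePath adj-sym (proj₂ (from-zero i)) ⊕ from-zero j
    where
    from-zero : ∀ j → Path (CycleAdj N) Fin.zero j
    from-zero = closed-next⇒all (Path (CycleAdj N) Fin.zero) (0 , here) (λ i p → p ⊕ edge (adj-next i))

module Functigraph (k : ℕ) (f : Fin (3 + k) → Fin (3 + k)) where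
  open Cycle k public

  V : Set
  V = Fin N ⊎ Fin N

  Adj : V → V → Set
  Adj = FunctiAdj (CycleAdj N) f

  vertices : List V
  vertices = map inj₁ (allFin N) ++ map inj₂ (allFin N)

  ∈-vertices : ∀ x → x ∈ vertices
  ∈-vertices (inj₁ u) = ∈-++⁺ˡ (∈-map⁺ inj₁ (∈-allFin u))
  ∈-vertices (inj₂ v) = ∈-++⁺ʳ (map inj₁ (allFin N)) (∈-map⁺ inj₂ (∈-allFin v))

  functi-adj? : ∀ x y → Dec (Adj x y)
  functi-adj? (inj₁ u) (inj₁ v) = adj? u v
  functi-adj? (inj₂ u) (inj₂ v) = adj? u v
  functi-adj? (inj₁ u) (inj₂ v) = v ≟F f u
  functi-adj? (inj₂ v) (inj₁ u) = v ≟F f u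

  lift₁ : ∀ {u v} → Path (CycleAdj N) u v → Path Adj (inj₁ u) (inj₁ v)
  lift₁ (l , w) = l , mapWalk inj₁ (λ e → e) w

  lift₂ : ∀ {u v} → Path (CycleAdj N) u v → Path Adj (inj₂ u) (inj₂ v)
  lift₂ (l , w) = l , mapWalk inj₂ (λ e → e) w

  functi-connected : ∀ x y → Path Adj x y
  functi-connected (inj₁ u) (inj₁ v) = lift₁ (connected u v)
  functi-connected (inj₂ u) (inj₂ v) = lift₂ (connected u v)
  functi-connected (inj₁ u) (inj₂ v) =
    edge {Adj = Adj} {y = inj₂ (f u)} refl ⊕ functi-connected (inj₂ (f u)) (inj₂ v)
  functi-connected (inj₂ v) (inj₁ u) =
    functi-connected (inj₂ v) (inj₂ (f u)) ⊕ edge {Adj = Adj} {x = inj₂ (f u)} refl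

  open FiniteGraph (≡-dec _≟F_ _≟F_) vertices ∈-vertices Adj functi-adj? functi-connected public

  -- Lower bound: the empty list separates nothing, and a single landmark
  -- cannot separate its two neighbours in its own copy of the cycle.
  resolving⇒2≤length : ∀ S → Resolving Adj S → 2 ≤ length S
  resolving⇒2≤length [] resolves with resolves (inj₁ Fin.zero) (inj₂ Fin.zero) (λ ())
  ... | _ , () , _
  resolving⇒2≤length (inj₁ u ∷ []) resolves =
    ⊥-elim (singleton-notResolving {Adj = Adj} (adj-sym (adj-next u)) (next≢ u ∘ inj₁-injective)
                                   (adj-prev u) (prev≢ u ∘ inj₁-injective)
                                   (next≢prev u ∘ inj₁-injective) resolves)
  resolving⇒2≤length (inj₂ v ∷ []) resolves =
    ⊥-elim (singleton-notResolving {Adj = Adj} (adj-sym (adj-next v)) (next≢ v ∘ inj₂-injective)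
                                   (adj-prev v) (prev≢ v ∘ inj₂-injective)
                                   (next≢prev v ∘ inj₂-injective) resolves)
  resolving⇒2≤length (_ ∷ _ ∷ _) _ = s≤s (s≤s z≤n)

  metricDim≥2 : ∀ {d} → IsMetricDim Adj d → 2 ≤ d
  metricDim≥2 ((S , (_ , resolvesS) , |S|≡d) , _) = subst (2 ≤_) |S|≡d (resolving⇒2≤length S resolvesS)

  InImage : Fin N → Set
  InImage v = ∃ λ u → f u ≡ v

  inImage? : ∀ v → Dec (InImage v)
  inImage? v = any? (λ u → f u ≟F v)

  image nonImage : List (Fin N)
  image = filter inImage? (allFin N)
  nonImage = filter (¬? ∘ inImage?) (allFin N)

  length-allFin : length (allFin N) ≡ N
  length-allFin = length-tabulate (λ i → i)

  imageSize+nonImage : imageSize f + length nonImage ≡ N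
  imageSize+nonImage = trans (length-filter-split inImage? (allFin N)) length-allFin

  Twin : Fin N → Set
  Twin u = Σ (Fin N) λ u′ → u′ ≢ u × f u′ ≡ f u

  -- The data from which a resolving set of size ≤ 2(N-1) - s is built:
  -- a vertex u₀ with a twin, a vertex a outside the image, and, when both
  -- neighbours of u₀ have the same image, a neighbour w of that image
  -- outside the image and different from a.
  record Anchor : Set where
    field
      u₀ : Fin N
      u₀-twin : Twin u₀
      a : Fin N
      a∉image : ¬ InImage a
      escape : f (prev u₀) ≡ f (next u₀) →
               Σ (Fin N) λ w → CycleAdj N (f (next u₀)) w × ¬ InImage w × w ≢ a

  module UpperBound (anchor : Anchor) where
    open Anchor anchor

    ≢u₀? : ∀ u → Dec (u ≢ u₀)
    ≢u₀? u = ¬? (u ≟F u₀)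

    ≢a? : ∀ v → Dec (v ≢ a)
    ≢a? v = ¬? (v ≟F a)

    others freeNonImage : List (Fin N)
    others = filter ≢u₀? (allFin N)
    freeNonImage = filter ≢a? nonImage

    S₀ : List V
    S₀ = map inj₁ others ++ map inj₂ freeNonImage

    inj₁∈S₀ : ∀ u → u ≢ u₀ → inj₁ u ∈ S₀
    inj₁∈S₀ u u≢u₀ = ∈-++⁺ˡ (∈-map⁺ inj₁ (∈-filter⁺ ≢u₀? (∈-allFin u) u≢u₀))

    inj₂∈S₀ : ∀ w → ¬ InImage w → w ≢ a → inj₂ w ∈ S₀
    inj₂∈S₀ w w∉image w≢a = ∈-++⁺ʳ (map inj₁ others) (∈-map⁺ inj₂
      (∈-filter⁺ ≢a? (∈-filter⁺ (¬? ∘ inImage?) (∈-allFin w) w∉image) w≢a))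

    -- Thanks to the twin of u₀, every image vertex has a preimage in S₀.
    preimage≢u₀ : ∀ v → InImage v → Σ (Fin N) λ p → p ≢ u₀ × f p ≡ v
    preimage≢u₀ v (u , fu≡v) with u ≟F u₀
    ... | no u≢u₀ = u , u≢u₀ , fu≡v
    ... | yes refl with u′ , u′≢u₀ , fu′≡fu₀ ← u₀-twin = u′ , u′≢u₀ , trans fu′≡fu₀ fu≡v

    -- An image vertex v of G₂ is separated from any other w of G₂ by a
    -- preimage of v in S₀.
    separate-image : ∀ {v w} → InImage v → v ≢ w → Separated Adj S₀ (inj₂ v) (inj₂ w)
    separate-image {v} {w} v∈image v≢w with p , p≢u₀ , fp≡v ← preimage≢u₀ v v∈image =
      separate-by-neighbour (inj₁∈S₀ p p≢u₀) (sym fp≡v) (λ ())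
                            (λ w≡fp → v≢w (trans (sym fp≡v) (sym w≡fp))) (λ ())

    -- u₀ is separated from each vertex v of G₂: by a neighbour of u₀ whose
    -- image is not v, or else through the escape vertex next to v.
    separate-u₀ : ∀ v → Separated Adj S₀ (inj₁ u₀) (inj₂ v)
    separate-u₀ v with f (next u₀) ≟F v
    ... | no f-next≢v =
      separate-by-neighbour (inj₁∈S₀ (next u₀) (next≢ u₀)) (adj-next u₀)
        (λ e → next≢ u₀ (sym (inj₁-injective e))) (f-next≢v ∘ sym) (λ ())
    ... | yes f-next≡v with f (prev u₀) ≟F v
    ...   | no f-prev≢v =
      separate-by-neighbour (inj₁∈S₀ (prev u₀) (prev≢ u₀)) (adj-sym (adj-prev u₀))
        (λ e → prev≢ u₀ (sym (inj₁-injective e))) (f-prev≢v ∘ sym) (λ ())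
    ...   | yes f-prev≡v
      with w , f-next~w , w∉image , w≢a ← escape (trans f-prev≡v (sym f-next≡v)) =
      Separated-sym (separate-by-neighbour (inj₂∈S₀ w w∉image w≢a)
        (subst (λ t → CycleAdj N t w) f-next≡v f-next~w)
        (λ e → w∉image (next u₀ , trans f-next≡v (inj₂-injective e)))
        (λ w≡fu₀ → w∉image (u₀ , sym w≡fu₀)) (λ ()))

    data Unlisted : V → Set where
      is-u₀ : Unlisted (inj₁ u₀)
      is-image : ∀ v → InImage v → Unlisted (inj₂ v)
      is-a : Unlisted (inj₂ a)

    classify : ∀ x → x ∈ S₀ ⊎ Unlisted x
    classify (inj₁ u) with u ≟F u₀
    ... | yes refl = inj₂ is-u₀
    ... | no u≢u₀ = inj₁ (inj₁∈S₀ u u≢u₀)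
    classify (inj₂ v) with inImage? v | v ≟F a
    ... | yes v∈image | _ = inj₂ (is-image v v∈image)
    ... | no _ | yes refl = inj₂ is-a
    ... | no v∉image | no v≢a = inj₁ (inj₂∈S₀ v v∉image v≢a)

    separate-unlisted : ∀ {x y} → Unlisted x → Unlisted y → x ≢ y → Separated Adj S₀ x y
    separate-unlisted is-u₀ is-u₀ x≢y = ⊥-elim (x≢y refl)
    separate-unlisted is-u₀ (is-image v _) _ = separate-u₀ v
    separate-unlisted is-u₀ is-a _ = separate-u₀ a
    separate-unlisted (is-image v _) is-u₀ _ = Separated-sym (separate-u₀ v)
    separate-unlisted is-a is-u₀ _ = Separated-sym (separate-u₀ a)
    separate-unlisted (is-image v v∈image) (is-image w _) x≢y = separate-image v∈image (x≢y ∘ cong inj₂)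
    separate-unlisted (is-image v v∈image) is-a x≢y = separate-image v∈image (x≢y ∘ cong inj₂)
    separate-unlisted is-a (is-image w w∈image) x≢y =
      Separated-sym (separate-image w∈image (x≢y ∘ cong inj₂ ∘ sym))
    separate-unlisted is-a is-a x≢y = ⊥-elim (x≢y refl)

    resolving : Resolving Adj S₀
    resolving x y x≢y with classify x | classify y
    ... | inj₁ x∈S₀ | _ = separate-by-member x∈S₀ x≢y
    ... | inj₂ _ | inj₁ y∈S₀ = Separated-sym (separate-by-member y∈S₀ (x≢y ∘ sym))
    ... | inj₂ ux | inj₂ uy = separate-unlisted ux uy x≢y

    unique : Unique S₀
    unique = ++⁺ (map⁺ inj₁-injective (filter⁺ ≢u₀? (allFin⁺ N)))
                 (map⁺ inj₂-injective (filter⁺ ≢a? (filter⁺ (¬? ∘ inImage?) (allFin⁺ N))))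
                 copies-disjoint
      where
      copies-disjoint : ∀ {x} → ¬ (x ∈ map inj₁ others × x ∈ map inj₂ freeNonImage)
      copies-disjoint (in₁ , in₂) with ∈-map⁻ inj₁ in₁ | ∈-map⁻ inj₂ in₂
      ... | _ , _ , refl | _ , _ , ()

    size-bound : length S₀ ≤ 2 * (N ∸ 1) ∸ imageSize f
    size-bound = subst (_≤ 2 * m ∸ imageSize f) (sym length-S₀)
      (sum-bound (imageSize f) others<N freeNonImage<nonImage imageSize+nonImage)
      where
      length-S₀ : length S₀ ≡ length others + length freeNonImage
      length-S₀ = trans (length-++ (map inj₁ others))
                        (cong₂ _+_ (length-map inj₁ others) (length-map inj₂ freeNonImage))
      others<N : length others < N
      others<N = subst (length others <_) length-allFin
        (filter-notAll ≢u₀? (allFin N) (lose (∈-allFin u₀) (λ u₀≢u₀ → u₀≢u₀ refl)))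
      freeNonImage<nonImage : length freeNonImage < length nonImage
      freeNonImage<nonImage = filter-notAll ≢a? nonImage
        (lose (∈-filter⁺ (¬? ∘ inImage?) (∈-allFin a) a∉image) (λ a≢a → a≢a refl))

    resolvingSet : ResolvingSet Adj S₀
    resolvingSet = unique , resolving

  covering⇒N≤length : (xs : List (Fin N)) → (∀ v → v ∈ xs) → N ≤ length xs
  covering⇒N≤length xs covers =
    subst (_≤ length xs) length-allFin (unique-⊆⇒length≤ (allFin⁺ N) xs (λ {v} _ → covers v))

  injective⇒N≤imageSize : (∀ {x y} → f x ≡ f y → x ≡ y) → N ≤ imageSize f
  injective⇒N≤imageSize injective =
    subst (_≤ imageSize f) (trans (length-map f (allFin N)) length-allFin)
      (unique-⊆⇒length≤ (map⁺ injective (allFin⁺ N)) image map-f⊆image)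
    where
    map-f⊆image : ∀ {v} → v ∈ map f (allFin N) → v ∈ image
    map-f⊆image v∈ with u , _ , refl ← ∈-map⁻ f v∈ = ∈-filter⁺ inImage? (∈-allFin (f u)) (u , refl)

  twin? : ∀ u → Dec (Twin u)
  twin? u = any? (λ u′ → ¬? (u′ ≟F u) ×-dec (f u′ ≟F f u))

  nonImage-vertex : imageSize f < N → Σ (Fin N) λ a → ¬ InImage a
  nonImage-vertex s<N with all? inImage?
  ... | yes surjective = ⊥-elim (ℕ.<-irrefl (trans (cong length image≡allFin) length-allFin) s<N)
    where
    image≡allFin : image ≡ allFin N
    image≡allFin = filter-all inImage? (All.tabulate λ {v} _ → surjective v)
  ... | no ¬surjective = ¬∀⟶∃¬ N InImage inImage? ¬surjective

  twin-exists : imageSize f < N → Σ (Fin N) Twin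
  twin-exists s<N with any? twin?
  ... | yes twin = twin
  ... | no no-twin = ⊥-elim (ℕ.<⇒≱ s<N (injective⇒N≤imageSize injective))
    where
    injective : ∀ {x y} → f x ≡ f y → x ≡ y
    injective {x} {y} fx≡fy with x ≟F y
    ... | yes x≡y = x≡y
    ... | no x≢y = ⊥-elim (no-twin (y , x , x≢y , fx≡fy))

  split-anchor : ∀ u → Twin u → f (prev u) ≢ f (next u) → Σ (Fin N) (λ a → ¬ InImage a) → Anchor
  split-anchor u u-twin split (a , a∉image) = record
    { u₀ = u ; u₀-twin = u-twin ; a = a ; a∉image = a∉image ; escape = ⊥-elim ∘ split }

  -- If instead every twin vertex has neighbours with equal images, then
  -- every vertex is a twin, f is 2-periodic along the cycle, and its image
  -- is {α, β} = {f p, f (next p)}.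
  module Periodic (p : Fin N) (p-twin : Twin p) (period : ∀ u → Twin u → f (prev u) ≡ f (next u)) where

    twin-everywhere : ∀ u → Twin u
    twin-everywhere = cycle-induction Twin
      (λ u u-twin → prev u , next≢prev u ∘ sym , period u u-twin)
      (λ u u-twin → next u , next≢prev u , sym (period u u-twin)) p p-twin

    two-periodic : ∀ u → f (next (next u)) ≡ f u
    two-periodic u = trans (sym (period (next u) (twin-everywhere (next u)))) (cong f (prev-next u))

    α β : Fin N
    α = f p
    β = f (next p)

    Alternates : Fin N → Set
    Alternates u = (f u ≡ α × f (next u) ≡ β) ⊎ (f u ≡ β × f (next u) ≡ α)

    alternates : ∀ u → Alternates u
    alternates = cycle-induction Alternates forward backward p (inj₁ (refl , refl))
      where
      forward : ∀ u → Alternates u → Alternates (next u)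
      forward u (inj₁ (fu≡α , f-next≡β)) = inj₂ (f-next≡β , trans (two-periodic u) fu≡α)
      forward u (inj₂ (fu≡β , f-next≡α)) = inj₁ (f-next≡α , trans (two-periodic u) fu≡β)
      f-prev≡f-next : ∀ u → f (prev u) ≡ f (next u)
      f-prev≡f-next u = period u (twin-everywhere u)
      backward : ∀ u → Alternates u → Alternates (prev u)
      backward u (inj₁ (fu≡α , f-next≡β)) =
        inj₂ (trans (f-prev≡f-next u) f-next≡β , trans (cong f (next-prev u)) fu≡α)
      backward u (inj₂ (fu≡β , f-next≡α)) =
        inj₁ (trans (f-prev≡f-next u) f-next≡α , trans (cong f (next-prev u)) fu≡β)

    image⊆αβ : ∀ v → InImage v → v ≡ α ⊎ v ≡ β
    image⊆αβ v (u , refl) with alternates u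
    ... | inj₁ (fu≡α , _) = inj₁ fu≡α
    ... | inj₂ (fu≡β , _) = inj₂ fu≡β

    -- One of the two neighbours of β avoids α, hence avoids the image.
    escape-vertex : Σ (Fin N) λ w → CycleAdj N β w × w ≢ α × w ≢ β
    escape-vertex with next β ≟F α
    ... | no next≢α = next β , adj-next β , next≢α , next≢ β
    ... | yes next≡α = prev β , adj-sym (adj-prev β) , (λ prev≡α → next≢prev β (trans next≡α (sym prev≡α))) , prev≢ β

    w : Fin N
    w = proj₁ escape-vertex

    w∉image : ¬ InImage w
    w∉image w∈image with escape-vertex | image⊆αβ w w∈image
    ... | _ , _ , w≢α , _ | inj₁ w≡α = w≢α w≡α
    ... | _ , _ , _ , w≢β | inj₂ w≡β = w≢β w≡β

    -- On the triangle α = β, so the image is a single vertex.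
    triangle-collapses : k ≡ 0 → imageSize f ≤ 1
    triangle-collapses k≡0 = unique-⊆⇒length≤ (filter⁺ inImage? (allFin⁺ N)) (α ∷ []) image⊆α
      where
      α≡β : α ≡ β
      α≡β = trans (sym (two-periodic p)) (trans (cong f (next-next≡prev k≡0 p)) (period p p-twin))
      image⊆α : ∀ {v} → v ∈ image → v ∈ α ∷ []
      image⊆α v∈image with image⊆αβ _ (proj₂ (∈-filter⁻ inImage? v∈image))
      ... | inj₁ v≡α = here v≡α
      ... | inj₂ v≡β = here (trans v≡β (sym α≡β))

    -- Since s > 1 there are at least four vertices, so some a ∉ {α, β, w}
    -- exists; u₀ = p with escape vertex w then form an anchor.
    anchor : 1 < imageSize f → Anchor
    anchor 1<s with any? (λ v → ¬? (v ≟F α) ×-dec ¬? (v ≟F β) ×-dec ¬? (v ≟F w))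
    ... | yes (a , a≢α , a≢β , a≢w) = record
      { u₀ = p ; u₀-twin = p-twin ; a = a
      ; a∉image = λ a∈image → [ a≢α , a≢β ] (image⊆αβ a a∈image)
      ; escape = λ _ → w , proj₁ (proj₂ escape-vertex) , w∉image , a≢w ∘ sym }
    ... | no none = ⊥-elim (ℕ.<⇒≱ 1<s (triangle-collapses (k≡0 (covering⇒N≤length (α ∷ β ∷ w ∷ []) covers))))
      where
      covers : ∀ v → v ∈ α ∷ β ∷ w ∷ []
      covers v with v ≟F α | v ≟F β | v ≟F w
      ... | yes v≡α | _ | _ = here v≡α
      ... | no _ | yes v≡β | _ = there (here v≡β)
      ... | no _ | no _ | yes v≡w = there (there (here v≡w))
      ... | no v≢α | no v≢β | no v≢w = ⊥-elim (none (v , v≢α , v≢β , v≢w))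
      k≡0 : N ≤ 3 → k ≡ 0
      k≡0 (s≤s (s≤s (s≤s k≤0))) = ℕ.n≤0⇒n≡0 k≤0

  find-anchor : 1 < imageSize f → imageSize f < N → Anchor
  find-anchor 1<s s<N with any? (λ u → twin? u ×-dec ¬? (f (prev u) ≟F f (next u)))
  ... | yes (u , u-twin , split) = split-anchor u u-twin split (nonImage-vertex s<N)
  ... | no no-split = Periodic.anchor p p-twin period 1<s
    where
    p : Fin N
    p = proj₁ (twin-exists s<N)
    p-twin : Twin p
    p-twin = proj₂ (twin-exists s<N)
    period : ∀ u → Twin u → f (prev u) ≡ f (next u)
    period u u-twin with f (prev u) ≟F f (next u)
    ... | yes equal = equal
    ... | no split = ⊥-elim (no-split (u , u-twin , split))

theorem4p6 : (n : ℕ) → 3 ≤ n → (f : Fin n → Fin n) → (s : ℕ) →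
    imageSize f ≡ s → 1 < s → s < n →
    Σ ℕ λ d → IsMetricDim (FunctiAdj (CycleAdj n) f) d ×
      2 ≤ d × d ≤ (2 * (n ∸ 1)) ∸ s
theorem4p6 (suc (suc (suc k))) (s≤s (s≤s (s≤s z≤n))) f _ refl 1<s s<n =
  let (d , isDim , d≤|S₀|) = metricDimension S₀ resolvingSet
  in d , isDim , metricDim≥2 isDim , ℕ.≤-trans d≤|S₀| size-bound
  where
  open Functigraph k f
  open UpperBound (find-anchor 1<s s<n)
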